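{- Let $d\ge 2$ and $D\ge 1$ be integers, and let $G$ be a finite graph that has a $d$-degenerate vertex ordering of depth $D$. Then \[ \mathrm{HG}(G) < 2^{d^{D+1}}. \]
   Context: Hat guessing game: players sit on the vertices of a finite simple graph $G$; an adversary places on each vertex a hat of one of $q$ colors. Each player sees only the hat colors of its neighbors (not its own) and, following a strategy agreed in advance (a deterministic function of the colors it sees), guesses its own hat color; all guess simultaneously. The players win if at least one player guesses correctly. The hat guessing number $\mathrm{HG}(G)$ is the largest $q$ for which the players have a strategy that wins for every hat assignment with $q$ colors. A vertex ordering $v_1,\dots,v_n$ of $G$ is $d$-degenerate if each vertex has at most $d$ neighbors to its left (i.e. among earlier vertices). Such an ordering has depth $D$ if the longest left-to-right path (a path $v_{i_0}v_{i_1}\cdots v_{i_k}$ in $G$ with $i_0<i_1<\dots<i_k$) contains $D$ edges. -}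

module Defs where

open import Data.Nat using (ℕ; zero; suc; _≤_; _<_)
open import Data.Fin using (Fin; inject₁; _<?_) renaming (_<_ to _<ᶠ_; suc to fsuc)
open import Data.Fin.Permutation using (Permutation′; _⟨$⟩ʳ_)
open import Data.List using (filter; length; allFin)
open import Data.Product using (Σ; _×_)
open import Relation.Binary using (Decidable)
open import Relation.Binary.PropositionalEquality using (_≡_)
open import Relation.Nullary using (¬_)
open import Relation.Nullary.Decidable using (_×-dec_)

record Graph : Set₁ where
  field
    n      : ℕ
    Adj    : Fin n → Fin n → Set
    sym    : ∀ {u v} → Adj u v → Adj v u
    irrefl : ∀ {v} → ¬ Adj v v
    adj?   : Decidable Adj

open Graph public

Colouring : Graph → ℕ → Set
Colouring G q = Fin (n G) → Fin q

record Strategy (G : Graph) (q : ℕ) : Set where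
  field
    guess : Fin (n G) → Colouring G q → Fin q
    local : ∀ v (c c′ : Colouring G q) →
            (∀ u → Adj G v u → c u ≡ c′ u) → guess v c ≡ guess v c′

open Strategy public

Winning : (G : Graph) (q : ℕ) → Strategy G q → Set
Winning G q s = ∀ (c : Colouring G q) → Σ (Fin (n G)) λ v → guess s v c ≡ c v

HatWins : Graph → ℕ → Set
HatWins G q = Σ (Strategy G q) (Winning G q)

-- A vertex ordering: π maps each vertex to its position (0 = leftmost).
Ordering : Graph → Set
Ordering G = Permutation′ (n G)

LeftNbr : (G : Graph) → Ordering G → Fin (n G) → Fin (n G) → Set
LeftNbr G π u v = Adj G u v × ((π ⟨$⟩ʳ u) <ᶠ (π ⟨$⟩ʳ v))

leftDegree : (G : Graph) → Ordering G → Fin (n G) → ℕ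
leftDegree G π v =
  length (filter (λ u → adj? G u v ×-dec ((π ⟨$⟩ʳ u) <? (π ⟨$⟩ʳ v))) (allFin (n G)))

Degenerate : (G : Graph) → Ordering G → ℕ → Set
Degenerate G π d = ∀ v → leftDegree G π v ≤ d

record LRPath (G : Graph) (π : Ordering G) (k : ℕ) : Set where
  field
    vtx  : Fin (suc k) → Fin (n G)
    step : ∀ (i : Fin k) → LeftNbr G π (vtx (inject₁ i)) (vtx (fsuc i))

HasDepth : (G : Graph) → Ordering G → ℕ → Set
HasDepth G π D = LRPath G π D × (∀ k → LRPath G π k → k ≤ D)

module Submission where

-- Give every vertex v a budget s(v) of colours with s(v) > ∏ s(u) over the left neighbours u of v,
-- and colour the vertices from right to left. When v is reached the colours to its right are fixed,
-- so its guess takes at most ∏ s(u) values as its left neighbours run through their budgets, and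
-- some colour within its budget is never guessed. Budgets are s = weight (D + 1), where weight 0 = 1
-- and weight (k + 1) v = 2 ∏ weight k u: since no left-to-right path has D + 1 edges, the recursion
-- is stationary at k = D + 1, and d-degeneracy bounds weight (D + 1) by 2 ^ (d ^ (D + 1)).

open import Defs hiding (sym)
open import Defs using () renaming (sym to adj-sym)
open import Data.Nat using (ℕ; zero; suc; z≤n; s≤s; _+_; _*_; _≤_; _<_; _^_)
open import Data.Nat.Properties
  using (≤-refl; ≤-reflexive; ≤-trans; <⇒≤; <⇒≱; ≰⇒>; <-irrefl; <-asym; <-cmp; ≤∧≢⇒<; m+1+n≰m;
         m≤m+n; m≤n+m; m<m+n; +-suc; +-identityʳ; +-monoˡ-≤; *-comm; *-mono-≤; *-monoˡ-≤; *-monoʳ-≤;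
         ^-*-assoc; ^-monoʳ-≤; module ≤-Reasoning)
open import Data.Nat.ListAction using (product)
open import Data.Fin using (Fin; inject₁; inject≤; toℕ; fromℕ<; _≟_; _<?_)
  renaming (zero to fzero; suc to fsuc)
open import Data.Fin.Properties
  using (toℕ<n; toℕ-fromℕ<; toℕ-inject≤; toℕ-injective; inject≤-injective; injective⇒≤; ¬∀⟶∃¬)
open import Data.Fin.Permutation using (_⟨$⟩ʳ_; _⟨$⟩ˡ_; inverseʳ)
open import Data.Vec.Functional using (updateAt)
open import Data.Vec.Functional.Properties using (updateAt-updates; updateAt-minimal)
open import Data.List using (List; []; _∷_; _++_; length; map; concatMap; filter; allFin)
open import Data.List.Properties using (length-++; length-map; length-tabulate; map-cong-local)
import Data.List.Relation.Unary.All as All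
open import Data.List.Relation.Unary.Any using (here; there; any?)
open import Data.List.Membership.Propositional using (_∈_; _∉_; lose)
open import Data.List.Membership.Propositional.Properties
  using (∈-filter⁺; ∈-filter⁻; ∈-allFin; ∈-map⁺; ∈-concatMap⁺)
open import Data.List.Membership.Setoid.Properties using (index-injective)
open import Data.Product using (Σ; ∃; _×_; _,_; proj₂)
open import Data.Empty using (⊥-elim)
open import Function using (const; _∘′_)
open import Function.Bundles using (Injection)
open import Function.Properties.Inverse using (↔⇒↣)
open import Relation.Binary using (tri<; tri≈; tri>)
open import Relation.Binary.PropositionalEquality
open import Relation.Nullary using (¬_; Dec; yes; no)
open import Relation.Nullary.Decidable using (_×-dec_)

private variable
  A B : Set

length-concatMap-const : ∀ {f : A → List B} {k} → (∀ x → length (f x) ≡ k) →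
                         ∀ xs → length (concatMap f xs) ≡ length xs * k
length-concatMap-const f-len [] = refl
length-concatMap-const {f = f} {k} f-len (x ∷ xs) = begin
  length (f x ++ concatMap f xs)            ≡⟨ length-++ (f x) ⟩
  length (f x) + length (concatMap f xs)    ≡⟨ cong₂ _+_ (f-len x) (length-concatMap-const f-len xs) ⟩
  k + length xs * k                         ∎
  where open ≡-Reasoning

1≤product-map : ∀ {f : A → ℕ} → (∀ x → 1 ≤ f x) → ∀ xs → 1 ≤ product (map f xs)
1≤product-map f≥1 []       = ≤-refl
1≤product-map f≥1 (x ∷ xs) = *-mono-≤ (f≥1 x) (1≤product-map f≥1 xs)

product-map≤^length : ∀ {f : A → ℕ} {b} → (∀ x → f x ≤ b) → ∀ xs → product (map f xs) ≤ b ^ length xs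
product-map≤^length f≤b []       = ≤-refl
product-map≤^length f≤b (x ∷ xs) = *-mono-≤ (f≤b x) (product-map≤^length f≤b xs)

length<⇒∃∉ : ∀ {m q} (xs : List (Fin q)) → m ≤ q → length xs < m → ∃ λ a → toℕ a < m × a ∉ xs
length<⇒∃∉ {m} {q} xs m≤q |xs|<m =
  let i , i∉xs = ¬∀⟶∃¬ m (λ i → embed i ∈ xs) (λ i → any? (embed i ≟_) xs) all∈xs
  in embed i , subst (_< m) (sym (toℕ-inject≤ i m≤q)) (toℕ<n i) , i∉xs
  where
  embed : Fin m → Fin q
  embed i = inject≤ i m≤q
  all∈xs : ¬ (∀ i → embed i ∈ xs)
  all∈xs i∈xs = <⇒≱ |xs|<m (injective⇒≤ λ {i} {j} eq →
    inject≤-injective m≤q m≤q i j (index-injective (setoid (Fin q)) (i∈xs i) (i∈xs j) eq))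

repunit : ℕ → ℕ → ℕ
repunit d zero    = 0
repunit d (suc k) = suc (repunit d k * d)

repunit<^ : ∀ {d} → 2 ≤ d → ∀ k → repunit d k < d ^ k
repunit<^ 2≤d zero = ≤-refl
repunit<^ {d} 2≤d (suc k) = begin
  2 + repunit d k * d      ≤⟨ +-monoˡ-≤ (repunit d k * d) 2≤d ⟩
  suc (repunit d k) * d    ≤⟨ *-monoˡ-≤ d (repunit<^ 2≤d k) ⟩
  d ^ k * d                ≡⟨ *-comm (d ^ k) d ⟩
  d ^ suc k                ∎
  where open ≤-Reasoning

module OrderedGraph (G : Graph) (π : Ordering G) where

  Vertex : Set
  Vertex = Fin (n G)

  position : Vertex → ℕ
  position v = toℕ (π ⟨$⟩ʳ v)

  position-injective : ∀ {u v} → position u ≡ position v → u ≡ v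
  position-injective eq = Injection.injective (↔⇒↣ π) (toℕ-injective eq)

  vertexAt : ∀ {t} → t < n G → Vertex
  vertexAt t<n = π ⟨$⟩ˡ fromℕ< t<n

  position-vertexAt : ∀ {t} (t<n : t < n G) → position (vertexAt t<n) ≡ t
  position-vertexAt t<n = trans (cong toℕ (inverseʳ π)) (toℕ-fromℕ< t<n)

  leftNbr? : ∀ v u → Dec (LeftNbr G π u v)
  leftNbr? v u = adj? G u v ×-dec ((π ⟨$⟩ʳ u) <? (π ⟨$⟩ʳ v))

  leftNbrs : Vertex → List Vertex
  leftNbrs v = filter (leftNbr? v) (allFin (n G))

  ∈-leftNbrs⁺ : ∀ {u v} → LeftNbr G π u v → u ∈ leftNbrs v
  ∈-leftNbrs⁺ {u} {v} = ∈-filter⁺ (leftNbr? v) (∈-allFin u)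

  ∈-leftNbrs⁻ : ∀ {u v} → u ∈ leftNbrs v → LeftNbr G π u v
  ∈-leftNbrs⁻ {v = v} = proj₂ ∘′ ∈-filter⁻ (leftNbr? v) {xs = allFin (n G)}

  data LeftPath : ℕ → Vertex → Vertex → Set where
    []  : ∀ {a} → LeftPath 0 a a
    _∷_ : ∀ {k a b c} → LeftNbr G π a b → LeftPath k b c → LeftPath (suc k) a c

  _∷ʳ_ : ∀ {k a b c} → LeftPath k a b → LeftNbr G π b c → LeftPath (suc k) a c
  []      ∷ʳ l = l ∷ []
  (l′ ∷ p) ∷ʳ l = l′ ∷ (p ∷ʳ l)

  vertices : ∀ {k a b} → LeftPath k a b → Fin (suc k) → Vertex
  vertices {a = a} []      _        = a
  vertices {a = a} (_ ∷ _) fzero    = a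
  vertices         (_ ∷ p) (fsuc i) = vertices p i

  vertices-head : ∀ {k a b} (p : LeftPath k a b) → vertices p fzero ≡ a
  vertices-head []      = refl
  vertices-head (_ ∷ _) = refl

  vertices-step : ∀ {k a b} (p : LeftPath k a b) (i : Fin k) →
                  LeftNbr G π (vertices p (inject₁ i)) (vertices p (fsuc i))
  vertices-step (l ∷ p) fzero    = subst (LeftNbr G π _) (sym (vertices-head p)) l
  vertices-step (_ ∷ p) (fsuc i) = vertices-step p i

  toLRPath : ∀ {k a b} → LeftPath k a b → LRPath G π k
  toLRPath p = record { vtx = vertices p ; step = vertices-step p }

  weight : ℕ → Vertex → ℕ
  weight zero    v = 1
  weight (suc k) v = 2 * product (map (weight k) (leftNbrs v))

  1≤weight : ∀ k v → 1 ≤ weight k v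
  1≤weight zero    v = ≤-refl
  1≤weight (suc k) v = ≤-trans (1≤product-map (1≤weight k) (leftNbrs v)) (m≤m+n _ _)

  weight-stable : ∀ {k v} → (∀ {a} → ¬ LeftPath k a v) → weight k v ≡ weight (suc k) v
  weight-stable {zero}      no-path = ⊥-elim (no-path [])
  weight-stable {suc k} {v} no-path = cong (λ ws → 2 * product ws) (map-cong-local (All.tabulate
    λ u∈ → weight-stable λ p → no-path (p ∷ʳ ∈-leftNbrs⁻ u∈)))

  product-weight<weight : ∀ {k v} → (∀ {a} → ¬ LeftPath k a v) →
                          product (map (weight k) (leftNbrs v)) < weight k v
  product-weight<weight {k} {v} no-path = begin-strict
    product (map (weight k) (leftNbrs v))   <⟨ m<m+n _ (≤-trans positive (m≤m+n _ 0)) ⟩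
    weight (suc k) v                        ≡⟨ sym (weight-stable no-path) ⟩
    weight k v                              ∎
    where
    open ≤-Reasoning
    positive : 1 ≤ product (map (weight k) (leftNbrs v))
    positive = 1≤product-map (1≤weight k) (leftNbrs v)

  weight≤2^repunit : ∀ {d} → Degenerate G π d → ∀ k v → weight k v ≤ 2 ^ repunit d k
  weight≤2^repunit deg zero    v = ≤-refl
  weight≤2^repunit {d} deg (suc k) v = *-monoʳ-≤ 2 (begin
    product (map (weight k) (leftNbrs v))   ≤⟨ product-map≤^length (weight≤2^repunit deg k) (leftNbrs v) ⟩
    (2 ^ repunit d k) ^ length (leftNbrs v) ≡⟨ ^-*-assoc 2 (repunit d k) _ ⟩
    2 ^ (repunit d k * length (leftNbrs v)) ≤⟨ ^-monoʳ-≤ 2 (*-monoʳ-≤ (repunit d k) (deg v)) ⟩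
    2 ^ (repunit d k * d)                   ∎)
    where open ≤-Reasoning

module Adversary (G : Graph) (π : Ordering G) {q} (st : Strategy G q) (s : Fin (n G) → ℕ)
                 (s≤q : ∀ v → s v ≤ q)
                 (product<s : ∀ v → product (map s (OrderedGraph.leftNbrs G π v)) < s v) where

  open OrderedGraph G π
  open import Data.List.Membership.DecPropositional (_≟_ {n G}) using (_∈?_)

  Admissible : Colouring G q → Set
  Admissible c = ∀ v → toℕ (c v) < s v

  palette : Vertex → List (Fin q)
  palette u = map (λ i → inject≤ i (s≤q u)) (allFin (s u))

  length-palette : ∀ u → length (palette u) ≡ s u
  length-palette u = trans (length-map _ (allFin (s u))) (length-tabulate _)

  ∈-palette : ∀ u {j : Fin q} → toℕ j < s u → j ∈ palette u
  ∈-palette u {j} j<s = subst (_∈ palette u) inject-fromℕ< (∈-map⁺ _ (∈-allFin (fromℕ< j<s)))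
    where
    inject-fromℕ< : inject≤ (fromℕ< j<s) (s≤q u) ≡ j
    inject-fromℕ< = toℕ-injective (trans (toℕ-inject≤ _ (s≤q u)) (toℕ-fromℕ< j<s))

  recolour : Colouring G q → Vertex → Fin q → Colouring G q
  recolour c u j = updateAt c u (const j)

  variations : List Vertex → Colouring G q → List (Colouring G q)
  variations []      c = c ∷ []
  variations (u ∷ ℓ) c = concatMap (λ j → variations ℓ (recolour c u j)) (palette u)

  length-variations : ∀ ℓ c → length (variations ℓ c) ≡ product (map s ℓ)
  length-variations []      c = refl
  length-variations (u ∷ ℓ) c = begin
    length (variations (u ∷ ℓ) c)
      ≡⟨ length-concatMap-const (λ j → length-variations ℓ (recolour c u j)) (palette u) ⟩
    length (palette u) * product (map s ℓ)  ≡⟨ cong (_* product (map s ℓ)) (length-palette u) ⟩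
    s u * product (map s ℓ)                 ∎
    where open ≡-Reasoning

  ∃-variation : ∀ ℓ c {c′} → Admissible c′ →
                ∃ λ c″ → c″ ∈ variations ℓ c × (∀ x → x ∈ ℓ → c″ x ≡ c′ x)
                                            × (∀ x → x ∉ ℓ → c″ x ≡ c x)
  ∃-variation []      c _ = c , here refl , (λ _ ()) , λ _ _ → refl
  ∃-variation (u ∷ ℓ) c {c′} adm with ∃-variation ℓ (recolour c u (c′ u)) adm
  ... | c″ , c″∈ , on-ℓ , off-ℓ =
    c″ , ∈-concatMap⁺ _ (lose (∈-palette u (adm u)) c″∈) , on-uℓ , off-uℓ
    where
    on-uℓ : ∀ x → x ∈ u ∷ ℓ → c″ x ≡ c′ x
    on-uℓ x (there x∈ℓ) = on-ℓ x x∈ℓ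
    on-uℓ x (here refl) with x ∈? ℓ
    ... | yes x∈ℓ = on-ℓ x x∈ℓ
    ... | no  x∉ℓ = trans (off-ℓ x x∉ℓ) (updateAt-updates x c)
    off-uℓ : ∀ x → x ∉ u ∷ ℓ → c″ x ≡ c x
    off-uℓ x x∉ = trans (off-ℓ x (x∉ ∘′ there)) (updateAt-minimal x u c (x∉ ∘′ here))

  FixedFrom : ℕ → Colouring G q → Colouring G q → Set
  FixedFrom t c c′ = ∀ u → t ≤ position u → c′ u ≡ c u

  Fools : ℕ → Colouring G q → Set
  Fools t c = ∀ v → t ≤ position v → ∀ c′ → Admissible c′ → FixedFrom t c c′ → guess st v c′ ≢ c v

  Foolable : ℕ → Set
  Foolable t = ∃ λ c → Admissible c × Fools t c

  guesses : Vertex → Colouring G q → List (Fin q)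
  guesses w c = map (guess st w) (variations (leftNbrs w) c)

  length-guesses<s : ∀ w c → length (guesses w c) < s w
  length-guesses<s w c = begin-strict
    length (guesses w c)                     ≡⟨ length-map (guess st w) (variations (leftNbrs w) c) ⟩
    length (variations (leftNbrs w) c)       ≡⟨ length-variations (leftNbrs w) c ⟩
    product (map s (leftNbrs w))             <⟨ product<s w ⟩
    s w                                      ∎
    where open ≤-Reasoning

  guess-∈-guesses : ∀ w c {c′} → Admissible c′ → FixedFrom (suc (position w)) c c′ →
                    guess st w c′ ∈ guesses w c
  guess-∈-guesses w c {c′} adm fixed with ∃-variation (leftNbrs w) c adm
  ... | c″ , c″∈ , on-left , off-left =
    subst (_∈ guesses w c) (sym (local st w c′ c″ agree)) (∈-map⁺ (guess st w) c″∈)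
    where
    agree : ∀ u → Adj G w u → c′ u ≡ c″ u
    agree u adj with <-cmp (position u) (position w)
    ... | tri< u<w _ _ = sym (on-left u (∈-leftNbrs⁺ (adj-sym G adj , u<w)))
    ... | tri≈ _ u≡w _ = ⊥-elim (irrefl G (subst (Adj G w) (position-injective u≡w) adj))
    ... | tri> _ _ w<u = trans (fixed u w<u)
                               (sym (off-left u λ u∈ → <-asym (proj₂ (∈-leftNbrs⁻ u∈)) w<u))

  fixedFrom-recolour : ∀ {w c c′ a} → FixedFrom (position w) (recolour c w a) c′ →
                       FixedFrom (suc (position w)) c c′
  fixedFrom-recolour {w} {c} fixed u w<u =
    trans (fixed u (<⇒≤ w<u)) (updateAt-minimal u w c λ { refl → <-irrefl refl w<u })

  foolable-step : ∀ w → Foolable (suc (position w)) → Foolable (position w)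
  foolable-step w (c , adm , fools) with length<⇒∃∉ (guesses w c) (s≤q w) (length-guesses<s w c)
  ... | a , a<s , a∉guesses = recolour c w a , adm′ , fools′
    where
    adm′ : Admissible (recolour c w a)
    adm′ v with v ≟ w
    ... | yes refl = subst (λ j → toℕ j < s w) (sym (updateAt-updates w c)) a<s
    ... | no  v≢w  = subst (λ j → toℕ j < s v) (sym (updateAt-minimal v w c v≢w)) (adm v)
    fools′ : Fools (position w) (recolour c w a)
    fools′ v w≤v c′ adm-c′ fixed with v ≟ w
    ... | yes refl = λ guess≡a → a∉guesses (subst (_∈ guesses w c) (trans guess≡a (updateAt-updates w c))
                                              (guess-∈-guesses w c adm-c′ (fixedFrom-recolour fixed)))
    ... | no  v≢w  = λ guess≡ → fools v w<v c′ adm-c′ (fixedFrom-recolour fixed)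
                                      (trans guess≡ (updateAt-minimal v w c v≢w))
      where
      w<v : position w < position v
      w<v = ≤∧≢⇒< w≤v λ w≡v → v≢w (position-injective (sym w≡v))

  foolable-n : Foolable (n G)
  foolable-n = c₀ , adm₀ , λ v n≤v → ⊥-elim (<⇒≱ (toℕ<n (π ⟨$⟩ʳ v)) n≤v)
    where
    0<s : ∀ v → 0 < s v
    0<s v = ≤-trans (s≤s z≤n) (product<s v)
    c₀ : Colouring G q
    c₀ v = fromℕ< (≤-trans (0<s v) (s≤q v))
    adm₀ : Admissible c₀
    adm₀ v = subst (_< s v) (sym (toℕ-fromℕ< _)) (0<s v)

  foolable : ∀ j t → j + t ≡ n G → Foolable t
  foolable zero    t refl  = foolable-n
  foolable (suc j) t j+t≡n = subst Foolable position-w≡t (foolable-step w foolable-right-of-w)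
    where
    t<n : t < n G
    t<n = ≤-trans (s≤s (m≤n+m t j)) (≤-reflexive j+t≡n)
    w : Vertex
    w = vertexAt t<n
    position-w≡t : position w ≡ t
    position-w≡t = position-vertexAt t<n
    foolable-right-of-w : Foolable (suc (position w))
    foolable-right-of-w rewrite position-w≡t = foolable j (suc t) (trans (+-suc j t) j+t≡n)

  ∃-losing-colouring : ∃ λ c → ∀ v → guess st v c ≢ c v
  ∃-losing-colouring =
    let c , adm , fools = foolable (n G) 0 (+-identityʳ (n G))
    in c , λ v → fools v z≤n c adm (λ _ _ → refl)

theorem2 : ∀ (d D : ℕ) → 2 ≤ d → 1 ≤ D → (G : Graph) →
           (Σ (Ordering G) λ π → Degenerate G π d × HasDepth G π D) →
           ∀ (q : ℕ) → HatWins G q → q < 2 ^ (d ^ (D + 1))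
theorem2 d D 2≤d _ G (π , deg , _ , longest) q (st , win) = ≰⇒> λ 2^≤q →
  let c , losing = Adversary.∃-losing-colouring G π st s (s≤q 2^≤q)
                     (λ _ → product-weight<weight no-long-path)
      v , correct = win c
  in losing v correct
  where
  open OrderedGraph G π
  s : Vertex → ℕ
  s = weight (D + 1)
  no-long-path : ∀ {a b} → ¬ LeftPath (D + 1) a b
  no-long-path p = m+1+n≰m D (longest (D + 1) (toLRPath p))
  s≤q : 2 ^ (d ^ (D + 1)) ≤ q → ∀ v → s v ≤ q
  s≤q 2^≤q v = ≤-trans (weight≤2^repunit deg (D + 1) v)
                       (≤-trans (^-monoʳ-≤ 2 (<⇒≤ (repunit<^ 2≤d (D + 1)))) 2^≤q)
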